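{- Let $\ell(k) := \lim_{n\to\infty} P(2n-1-|S-S| = k)$, where $S$ is a uniformly random subset of $[n]=\{0,\dots,n-1\}$ (this limit exists for every $k\ge 0$). Then for every integer $k\ge 0$, $\ell(2k+2) \ge \ell(2k)/2$.
   Context: For a positive integer $n$, $[n] := \{0,1,\dots,n-1\}$, random subsets are uniform over all $2^n$ subsets, and $S-S := \{x-y : x,y\in S\}$. -}

module Defs where

open import Data.Nat using (ℕ; zero; suc; _+_; _*_)
open import Data.Integer as ℤ using (ℤ; +_)
open import Data.List using (List; []; _∷_; _++_; map; concatMap; length; filter; deduplicate; upTo)

subsets : ℕ → List (List ℕ)
subsets zero    = [] ∷ []
subsets (suc n) = subsets n ++ map (n ∷_) (subsets n)

differences : List ℕ → List ℤ
differences S = concatMap (λ x → map (λ y → (+ x) ℤ.- (+ y)) S) S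

diffSetSize : List ℕ → ℕ
diffSetSize S = length (deduplicate ℤ._≟_ (differences S))

defect : ℕ → List ℕ → ℤ
defect n S = (+ (2 * n) ℤ.- + 1) ℤ.- + diffSetSize S

-- count n k = #{ S ⊆ [n] : 2n - 1 - |S - S| = k },
-- so that P(2n-1-|S-S| = k) = count n k / 2^n.
count : ℕ → ℕ → ℕ
count n k = length (filter (λ S → defect n S ℤ.≟ + k) (subsets n))

module Submission where

-- Write |S − S| = 1 + 2·#{d ≥ 1 : d ∈ S − S}. Split [n] into [L], the point L and the top a
-- points, L ≤ a, and map S ⊆ [n] to S′ ⊆ [n − 1] by deleting L and shifting the top down by
-- one. If S − S ⊇ {1, …, a} and S′ − S′ ⊇ {1, …, a − 1}, every larger difference joins [L] to
-- the top part and just shrinks by one, so |S − S| drops by exactly 2 and the defect 2k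
-- becomes 2k + 2. The map is two-to-one, hence p_n(2k) ≤ 2 p_n(2k + 2) + ε, where ε accounts
-- for a small difference missing from S or S′. A difference d is missing with probability at
-- most (3/4)^p when p disjoint pairs {x, x + d} fit into [n]; as n − d > L these bounds decay
-- geometrically in n − d, so ε = O((3/4)^(L/4)), which is below 2/(m + 1) once L is large.

open import Defs
open import Algebra.Properties.CommutativeSemigroup using (interchange; x∙yz≈y∙xz)
open import Data.Bool.Base using (Bool; true; false)
open import Data.Integer.Base as ℤ using (ℤ; +_; -[1+_]; _⊖_; ∣_∣)
import Data.Integer.Properties as ℤP
import Data.Integer.Tactic.RingSolver as ℤSolver
open import Data.List.Base
  using (List; []; _∷_; _++_; [_]; length; reverse; filter; map; deduplicate)
open import Data.List.Properties
  using (length-++; length-++-sucʳ; length-++-≤ʳ; reverse-++; length-reverse; filter-++)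
open import Data.List.Membership.Propositional using (_∈_; find; lose)
open import Data.List.Membership.Propositional.Properties
  using (∈-map⁺; ∈-map⁻; ∈-concatMap⁺; ∈-concatMap⁻; ∈-filter⁺; ∈-filter⁻; deduplicate-∈⇔)
open import Data.List.Membership.Propositional.Properties.WithK using (unique∧set⇒bag)
open import Data.List.Membership.DecPropositional ℤP._≟_ using (_∈?_)
open import Data.List.Relation.Binary.BagAndSetEquality using (∼bag⇒↭)
open import Data.List.Relation.Binary.Permutation.Propositional.Properties using (↭-length)
import Data.List.Relation.Unary.All as All
open import Data.List.Relation.Unary.AllPairs using ([]; _∷_)
open import Data.List.Relation.Unary.Any using (here; there)
open import Data.List.Relation.Unary.Unique.Propositional using (Unique)
import Data.List.Relation.Unary.Unique.Propositional.Properties as Unique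
open import Data.List.Relation.Unary.Unique.DecPropositional.Properties ℤP._≟_ using (deduplicate-!)
open import Data.Nat.Base
  using (ℕ; zero; suc; _+_; _*_; _^_; _≤_; _<_; _∸_; z≤n; s≤s; z<s; NonZero; >-nonZero⁻¹)
open import Data.Nat.Induction using (<-wellFounded)
open import Data.Nat.Properties
open import Data.Nat.Tactic.RingSolver using (solve-∀)
open import Data.Product.Base using (_×_; _,_; proj₁; proj₂; ∃-syntax)
open import Function.Bundles using (Equivalence; mk⇔)
open import Induction.WellFounded using (Acc; acc)
open import Relation.Binary.PropositionalEquality
  using (_≡_; _≢_; refl; sym; trans; cong; cong₂; subst; subst₂; module ≡-Reasoning)
open import Relation.Nullary.Decidable.Core using (Dec; yes; no; _because_; does; ¬?)
open import Relation.Nullary.Negation.Core using (contradiction)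
open import Relation.Unary using (Decidable)

+-interchange : ∀ a b c d → (a + b) + (c + d) ≡ (a + c) + (b + d)
+-interchange = interchange +-commutativeSemigroup

*-left-comm : ∀ x y z → x * (y * z) ≡ y * (x * z)
*-left-comm = x∙yz≈y∙xz *-commutativeSemigroup

∑< : ℕ → (ℕ → ℕ) → ℕ
∑< zero    f = 0
∑< (suc k) f = ∑< k f + f k

syntax ∑< k (λ i → e) = ∑[ i < k ] e

∑<-cong : ∀ k {f g : ℕ → ℕ} → (∀ {i} → i < k → f i ≡ g i) → ∑< k f ≡ ∑< k g
∑<-cong zero    eq = refl
∑<-cong (suc k) eq = cong₂ _+_ (∑<-cong k (λ i<k → eq (m<n⇒m<1+n i<k))) (eq ≤-refl)

∑<-mono : ∀ k {f g : ℕ → ℕ} → (∀ {i} → i < k → f i ≤ g i) → ∑< k f ≤ ∑< k g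
∑<-mono zero    le = z≤n
∑<-mono (suc k) le = +-mono-≤ (∑<-mono k (λ i<k → le (m<n⇒m<1+n i<k))) (le ≤-refl)

∑<-+ : ∀ a b (f : ℕ → ℕ) → ∑[ i < a + b ] f i ≡ ∑< a f + ∑[ i < b ] f (a + i)
∑<-+ a zero    f rewrite +-identityʳ a = sym (+-identityʳ _)
∑<-+ a (suc b) f rewrite +-suc a b =
  trans (cong (_+ f (a + b)) (∑<-+ a b f)) (+-assoc (∑< a f) _ (f (a + b)))

∑<-const : ∀ k c → ∑[ i < k ] c ≡ k * c
∑<-const zero    c = refl
∑<-const (suc k) c = trans (cong (_+ c) (∑<-const k c)) (+-comm (k * c) c)

∑<-≤ : ∀ k {f : ℕ → ℕ} {B} → (∀ {i} → i < k → f i ≤ B) → ∑< k f ≤ k * B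
∑<-≤ k {B = B} le = ≤-trans (∑<-mono k le) (≤-reflexive (∑<-const k B))

*-distribˡ-∑< : ∀ c k (f : ℕ → ℕ) → c * ∑< k f ≡ ∑[ i < k ] (c * f i)
*-distribˡ-∑< c zero    f = *-zeroʳ c
*-distribˡ-∑< c (suc k) f =
  trans (*-distribˡ-+ c (∑< k f) (f k)) (cong (_+ c * f k) (*-distribˡ-∑< c k f))

𝟙 : {P : Set} → Dec P → ℕ
𝟙 (true  because _) = 1
𝟙 (false because _) = 0

𝟙≤1 : {P : Set} (p? : Dec P) → 𝟙 p? ≤ 1
𝟙≤1 (true  because _) = ≤-refl
𝟙≤1 (false because _) = z≤n

𝟙-yes : {P : Set} (p? : Dec P) → P → 𝟙 p? ≡ 1
𝟙-yes (yes _) _ = refl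
𝟙-yes (no ¬p) p = contradiction p ¬p

𝟙-mono : {P Q : Set} (p? : Dec P) (q? : Dec Q) → (P → Q) → 𝟙 p? ≤ 𝟙 q?
𝟙-mono (no _)  _       _   = z≤n
𝟙-mono (yes p) (yes _) _   = ≤-refl
𝟙-mono (yes p) (no ¬q) p⇒q = contradiction (p⇒q p) ¬q

𝟙-cong : {P Q : Set} (p? : Dec P) (q? : Dec Q) → (P → Q) → (Q → P) → 𝟙 p? ≡ 𝟙 q?
𝟙-cong p? q? p⇒q q⇒p = ≤-antisym (𝟙-mono p? q? p⇒q) (𝟙-mono q? p? q⇒p)

𝟙-¬all≤∑ : ∀ {P : ℕ → Set} (P? : Decidable P) a →
           𝟙 (¬? (allUpTo? P? a)) ≤ ∑[ d < a ] 𝟙 (¬? (P? d))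
𝟙-¬all≤∑ P? zero = z≤n
𝟙-¬all≤∑ P? (suc a) with P? a | allUpTo? P? a | 𝟙-¬all≤∑ P? a
... | no  _ | _     | _  = m≤n+m 1 _
... | yes _ | no  _ | ih = ≤-trans ih (m≤m+n _ 0)
... | yes _ | yes _ | _  = z≤n

∑ᵇ : ℕ → (List Bool → ℕ) → ℕ
∑ᵇ zero    f = f []
∑ᵇ (suc n) f = ∑ᵇ n (λ bs → f (false ∷ bs)) + ∑ᵇ n (λ bs → f (true ∷ bs))

∑ᵇ-mono : ∀ n {f g : List Bool → ℕ} → (∀ bs → length bs ≡ n → f bs ≤ g bs) → ∑ᵇ n f ≤ ∑ᵇ n g
∑ᵇ-mono zero    le = le [] refl
∑ᵇ-mono (suc n) le = +-mono-≤ (∑ᵇ-mono n (λ bs eq → le (false ∷ bs) (cong suc eq)))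
                              (∑ᵇ-mono n (λ bs eq → le (true ∷ bs) (cong suc eq)))

∑ᵇ-cong : ∀ n {f g : List Bool → ℕ} → (∀ bs → length bs ≡ n → f bs ≡ g bs) → ∑ᵇ n f ≡ ∑ᵇ n g
∑ᵇ-cong n eq = ≤-antisym (∑ᵇ-mono n (λ bs l → ≤-reflexive (eq bs l)))
                         (∑ᵇ-mono n (λ bs l → ≤-reflexive (sym (eq bs l))))

∑ᵇ-+ : ∀ n (f g : List Bool → ℕ) → ∑ᵇ n (λ bs → f bs + g bs) ≡ ∑ᵇ n f + ∑ᵇ n g
∑ᵇ-+ zero    f g = refl
∑ᵇ-+ (suc n) f g =
  trans (cong₂ _+_ (∑ᵇ-+ n (λ bs → f (false ∷ bs)) (λ bs → g (false ∷ bs)))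
                   (∑ᵇ-+ n (λ bs → f (true ∷ bs)) (λ bs → g (true ∷ bs))))
        (+-interchange (∑ᵇ n (λ bs → f (false ∷ bs))) (∑ᵇ n (λ bs → g (false ∷ bs)))
                       (∑ᵇ n (λ bs → f (true ∷ bs))) (∑ᵇ n (λ bs → g (true ∷ bs))))

∑ᵇ-*ˡ : ∀ n c (f : List Bool → ℕ) → ∑ᵇ n (λ bs → c * f bs) ≡ c * ∑ᵇ n f
∑ᵇ-*ˡ zero    c f = refl
∑ᵇ-*ˡ (suc n) c f = trans (cong₂ _+_ (∑ᵇ-*ˡ n c _) (∑ᵇ-*ˡ n c _)) (sym (*-distribˡ-+ c _ _))

∑ᵇ-*ʳ : ∀ n (f : List Bool → ℕ) c → ∑ᵇ n (λ bs → f bs * c) ≡ ∑ᵇ n f * c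
∑ᵇ-*ʳ n f c =
  trans (∑ᵇ-cong n (λ bs _ → *-comm (f bs) c)) (trans (∑ᵇ-*ˡ n c f) (*-comm c (∑ᵇ n f)))

∑ᵇ-const : ∀ n c → ∑ᵇ n (λ _ → c) ≡ 2 ^ n * c
∑ᵇ-const zero    c = sym (+-identityʳ c)
∑ᵇ-const (suc n) c = trans (cong₂ _+_ (∑ᵇ-const n c) (∑ᵇ-const n c)) (double (2 ^ n) c)
  where
  double : ∀ p c → p * c + p * c ≡ (2 * p) * c
  double = solve-∀

∑ᵇ-zero : ∀ n → ∑ᵇ n (λ _ → 0) ≡ 0
∑ᵇ-zero n = trans (∑ᵇ-const n 0) (*-zeroʳ (2 ^ n))

∑ᵇ-≤ : ∀ n {f : List Bool → ℕ} {c} → (∀ bs → f bs ≤ c) → ∑ᵇ n f ≤ 2 ^ n * c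
∑ᵇ-≤ n {c = c} le = ≤-trans (∑ᵇ-mono n (λ bs _ → le bs)) (≤-reflexive (∑ᵇ-const n c))

∑ᵇ-++ : ∀ a b (f : List Bool → ℕ) → ∑ᵇ (a + b) f ≡ ∑ᵇ a (λ xs → ∑ᵇ b (λ ys → f (xs ++ ys)))
∑ᵇ-++ zero    b f = refl
∑ᵇ-++ (suc a) b f = cong₂ _+_ (∑ᵇ-++ a b _) (∑ᵇ-++ a b _)

∑ᵇ-∑< : ∀ n k (g : ℕ → List Bool → ℕ) → ∑ᵇ n (λ bs → ∑[ i < k ] g i bs) ≡ ∑[ i < k ] ∑ᵇ n (g i)
∑ᵇ-∑< n zero    g = ∑ᵇ-zero n
∑ᵇ-∑< n (suc k) g = trans (∑ᵇ-+ n _ (g k)) (cong (_+ ∑ᵇ n (g k)) (∑ᵇ-∑< n k g))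

bit : List Bool → ℕ → Bool
bit []       _       = false
bit (b ∷ _)  zero    = b
bit (_ ∷ bs) (suc i) = bit bs i

bit-++ˡ : ∀ us {vs i} → i < length us → bit (us ++ vs) i ≡ bit us i
bit-++ˡ (u ∷ us) {i = zero}  _          = refl
bit-++ˡ (u ∷ us) {i = suc i} (s≤s i<us) = bit-++ˡ us i<us

bit-++ʳ : ∀ us {vs} i → bit (us ++ vs) (length us + i) ≡ bit vs i
bit-++ʳ []       i = refl
bit-++ʳ (u ∷ us) i = bit-++ʳ us i

bit-true⇒< : ∀ bs {i} → bit bs i ≡ true → i < length bs
bit-true⇒< (b ∷ bs) {zero}  _  = s≤s z≤n
bit-true⇒< (b ∷ bs) {suc i} eq = s≤s (bit-true⇒< bs eq)

-- bs encodes a subset of [length bs]; its head is the bit of the largest element, matching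
-- the recursion of subsets.
mem : List Bool → ℕ → Bool
mem bs = bit (reverse bs)

toSet : List Bool → List ℕ
toSet []           = []
toSet (false ∷ bs) = toSet bs
toSet (true  ∷ bs) = length bs ∷ toSet bs

mem-++ˡ : ∀ xs ys {x} → x < length ys → mem (xs ++ ys) x ≡ mem ys x
mem-++ˡ xs ys x<ys rewrite reverse-++ xs ys =
  bit-++ˡ (reverse ys) (subst (_ <_) (sym (length-reverse ys)) x<ys)

mem-++ʳ : ∀ xs ys i → mem (xs ++ ys) (length ys + i) ≡ mem xs i
mem-++ʳ xs ys i rewrite reverse-++ xs ys =
  trans (cong (λ m → bit (reverse ys ++ reverse xs) (m + i)) (sym (length-reverse ys)))
        (bit-++ʳ (reverse ys) i)

mem-true⇒< : ∀ bs {x} → mem bs x ≡ true → x < length bs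
mem-true⇒< bs eq = subst (_ <_) (length-reverse bs) (bit-true⇒< (reverse bs) eq)

mem-++⁺ʳ : ∀ xs ys {x} → mem ys x ≡ true → mem (xs ++ ys) x ≡ true
mem-++⁺ʳ xs ys x∈ = trans (mem-++ˡ xs ys (mem-true⇒< ys x∈)) x∈

mem-∷-length : ∀ b bs → mem (b ∷ bs) (length bs) ≡ b
mem-∷-length b bs =
  trans (cong (mem (b ∷ bs)) (sym (+-identityʳ (length bs)))) (mem-++ʳ [ b ] bs 0)

∈-toSet⇒< : ∀ bs {x} → x ∈ toSet bs → x < length bs
∈-toSet⇒< (false ∷ bs) x∈          = m<n⇒m<1+n (∈-toSet⇒< bs x∈)
∈-toSet⇒< (true  ∷ bs) (here refl) = ≤-refl
∈-toSet⇒< (true  ∷ bs) (there x∈)  = m<n⇒m<1+n (∈-toSet⇒< bs x∈)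

∈-toSet⇒≤ : ∀ bs {m} → length bs ≤ suc m → ∀ {x} → x ∈ toSet bs → x ≤ m
∈-toSet⇒≤ bs bs≤ x∈ = ≤-pred (≤-trans (∈-toSet⇒< bs x∈) bs≤)

∈-toSet-∷ : ∀ b bs {x} → x ∈ toSet bs → x ∈ toSet (b ∷ bs)
∈-toSet-∷ false bs x∈ = x∈
∈-toSet-∷ true  bs x∈ = there x∈

∈-toSet⇒mem : ∀ bs {x} → x ∈ toSet bs → mem bs x ≡ true
∈-toSet⇒mem (false ∷ bs) x∈          = mem-++⁺ʳ [ false ] bs (∈-toSet⇒mem bs x∈)
∈-toSet⇒mem (true  ∷ bs) (here refl) = mem-∷-length true bs
∈-toSet⇒mem (true  ∷ bs) (there x∈)  = mem-++⁺ʳ [ true ] bs (∈-toSet⇒mem bs x∈)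

mem⇒∈-toSet : ∀ bs {x} → mem bs x ≡ true → x ∈ toSet bs
mem⇒∈-toSet (b ∷ bs) {x} eq with x <? length bs
... | yes x<bs = ∈-toSet-∷ b bs (mem⇒∈-toSet bs (trans (sym (mem-++ˡ [ b ] bs x<bs)) eq))
... | no  x≮bs with refl ← ≤-antisym (≤-pred (mem-true⇒< (b ∷ bs) eq)) (≮⇒≥ x≮bs) =
  top (trans (sym (mem-∷-length b bs)) eq)
  where
  top : b ≡ true → length bs ∈ toSet (b ∷ bs)
  top refl = here refl

length-filter-map : ∀ {A B : Set} {P : B → Set} (P? : Decidable P) (f : A → B) xs →
                    length (filter P? (map f xs)) ≡ length (filter (λ x → P? (f x)) xs)
length-filter-map P? f []       = refl
length-filter-map P? f (x ∷ xs) with does (P? (f x))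
... | true  = cong suc (length-filter-map P? f xs)
... | false = length-filter-map P? f xs

length-filter-∷ : ∀ {A : Set} {P : A → Set} (P? : Decidable P) x xs →
                  length (filter P? (x ∷ xs)) ≡ 𝟙 (P? x) + length (filter P? xs)
length-filter-∷ P? x xs with P? x
... | yes _ = refl
... | no  _ = refl

length-filter-subsets : ∀ {P : List ℕ → Set} (P? : Decidable P) n →
                        length (filter P? (subsets n)) ≡ ∑ᵇ n (λ bs → 𝟙 (P? (toSet bs)))
length-filter-subsets P? zero with P? []
... | yes _ = refl
... | no  _ = refl
length-filter-subsets P? (suc n) = begin
  length (filter P? (subsets n ++ map (n ∷_) (subsets n)))
    ≡⟨ cong length (filter-++ P? (subsets n) _) ⟩
  length (filter P? (subsets n) ++ filter P? (map (n ∷_) (subsets n)))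
    ≡⟨ length-++ (filter P? (subsets n)) ⟩
  length (filter P? (subsets n)) + length (filter P? (map (n ∷_) (subsets n)))
    ≡⟨ cong₂ _+_ (length-filter-subsets P? n)
                 (trans (length-filter-map P? (n ∷_) (subsets n))
                        (length-filter-subsets (λ S → P? (n ∷ S)) n)) ⟩
  ∑ᵇ n (λ bs → 𝟙 (P? (toSet bs))) + ∑ᵇ n (λ bs → 𝟙 (P? (n ∷ toSet bs)))
    ≡⟨ cong (λ k → ∑ᵇ n (λ bs → 𝟙 (P? (toSet bs))) + k)
            (∑ᵇ-cong n (λ bs |bs| → cong (λ m → 𝟙 (P? (m ∷ toSet bs))) (sym |bs|))) ⟩
  ∑ᵇ (suc n) (λ bs → 𝟙 (P? (toSet bs))) ∎
  where open ≡-Reasoning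

[m+n]⊖m≡n : ∀ m n → (m + n) ⊖ m ≡ + n
[m+n]⊖m≡n m n = trans (ℤP.⊖-≥ (m≤m+n m n)) (cong +_ (m+n∸m≡n m n))

⊖≡+⇒ : ∀ {x y d} → x ⊖ y ≡ + d → x ≡ y + d
⊖≡+⇒ {x} {y} {d} eq = ℤP.+-injective (begin
  + x           ≡⟨ [m+n]⊖m≡n y x ⟨
  (y + x) ⊖ y   ≡⟨ cong (_⊖ y) (+-comm y x) ⟩
  (x + y) ⊖ y   ≡⟨ ℤP.distribˡ-⊖-+-pos y x y ⟨
  x ⊖ y ℤ.+ + y ≡⟨ cong (ℤ._+ + y) eq ⟩
  + d ℤ.+ + y   ≡⟨ ℤP.pos-+ d y ⟨
  + (d + y)     ≡⟨ cong +_ (+-comm d y) ⟩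
  + (y + d)     ∎)
  where open ≡-Reasoning

∈-differences⁺ : ∀ S {x y} → x ∈ S → y ∈ S → x ⊖ y ∈ differences S
∈-differences⁺ S {x} {y} x∈S y∈S = ∈-concatMap⁺ (λ x → map (λ y → + x ℤ.- + y) S) {xs = S}
  (lose x∈S (subst (_∈ map (λ y → + x ℤ.- + y) S) (ℤP.m-n≡m⊖n x y)
                   (∈-map⁺ (λ y → + x ℤ.- + y) y∈S)))

∈-differences⁻ : ∀ S {z} → z ∈ differences S → ∃[ x ] ∃[ y ] x ∈ S × y ∈ S × z ≡ x ⊖ y
∈-differences⁻ S z∈ with find (∈-concatMap⁻ (λ x → map (λ y → + x ℤ.- + y) S) {xs = S} z∈)
... | x , x∈S , z∈row with ∈-map⁻ (λ y → + x ℤ.- + y) z∈row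
... | y , y∈S , refl = x , y , x∈S , y∈S , ℤP.m-n≡m⊖n x y

+∈-differences⁺ : ∀ S {y d} → y ∈ S → y + d ∈ S → + d ∈ differences S
+∈-differences⁺ S {y} {d} y∈S y+d∈S =
  subst (_∈ differences S) ([m+n]⊖m≡n y d) (∈-differences⁺ S y+d∈S y∈S)

+∈-differences⁻ : ∀ S {d} → + d ∈ differences S → ∃[ y ] y ∈ S × y + d ∈ S
+∈-differences⁻ S d∈ with ∈-differences⁻ S d∈
... | x , y , x∈S , y∈S , eq = y , y∈S , subst (_∈ S) (⊖≡+⇒ (sym eq)) x∈S

neg-∈-differences : ∀ S {z} → z ∈ differences S → ℤ.- z ∈ differences S
neg-∈-differences S z∈ with ∈-differences⁻ S z∈
... | x , y , x∈S , y∈S , refl =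
  subst (_∈ differences S) (ℤP.⊖-swap y x) (∈-differences⁺ S y∈S x∈S)

0∈-differences : ∀ S {x} → x ∈ S → + 0 ∈ differences S
0∈-differences S {x} x∈S = subst (_∈ differences S) (ℤP.n⊖n≡0 x) (∈-differences⁺ S x∈S x∈S)

∈-differences⇒∣∣≤ : ∀ S {m z} → (∀ {x} → x ∈ S → x ≤ m) → z ∈ differences S → ∣ z ∣ ≤ m
∈-differences⇒∣∣≤ S bound z∈ with ∈-differences⁻ S z∈
... | x , y , x∈S , y∈S , refl = ≤-trans (ℤP.∣m⊝n∣≤m⊔n x y) (⊔-lub (bound x∈S) (bound y∈S))

range± : ℕ → List ℤ
range± zero    = + 0 ∷ []
range± (suc m) = + suc m ∷ -[1+ m ] ∷ range± m

∈-range±⁻ : ∀ m {z} → z ∈ range± m → ∣ z ∣ ≤ m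
∈-range±⁻ zero    (here refl)         = z≤n
∈-range±⁻ (suc m) (here refl)         = ≤-refl
∈-range±⁻ (suc m) (there (here refl)) = ≤-refl
∈-range±⁻ (suc m) (there (there z∈))  = m≤n⇒m≤1+n (∈-range±⁻ m z∈)

∈-range±⁺ : ∀ m z → ∣ z ∣ ≤ m → z ∈ range± m
∈-range±⁺ zero    (+ zero)  _    = here refl
∈-range±⁺ (suc m) (+ j)     ∣z∣≤ with j ≟ suc m
... | yes refl = here refl
... | no  j≢   = there (there (∈-range±⁺ m (+ j) (≤-pred (≤∧≢⇒< ∣z∣≤ j≢))))
∈-range±⁺ (suc m) -[1+ j ]  ∣z∣≤ with j ≟ m
... | yes refl = there (here refl)
... | no  j≢   = there (there (∈-range±⁺ m -[1+ j ] (≤∧≢⇒< (≤-pred ∣z∣≤) j≢)))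

range±-unique : ∀ m → Unique (range± m)
range±-unique zero    = All.[] ∷ []
range±-unique (suc m) =
  ((λ ()) All.∷ All.tabulate (λ z∈ eq → outside z∈ (sym (cong ∣_∣ eq))))
  ∷ All.tabulate (λ z∈ eq → outside z∈ (sym (cong ∣_∣ eq))) ∷ range±-unique m
  where
  outside : ∀ {z} → z ∈ range± m → ∣ z ∣ ≢ suc m
  outside z∈ eq = n≮n m (subst (_≤ m) eq (∈-range±⁻ m z∈))

length-filter-range± : ∀ {P : ℤ → Set} (P? : Decidable P) → P (+ 0) →
  (∀ {d} → P -[1+ d ] → P (+ suc d)) → (∀ {d} → P (+ suc d) → P -[1+ d ]) →
  ∀ m → length (filter P? (range± m)) ≡ suc (2 * ∑[ d < m ] 𝟙 (P? (+ suc d)))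
length-filter-range± P? P0 _ _ zero =
  trans (length-filter-∷ P? (+ 0) []) (cong (_+ 0) (𝟙-yes (P? (+ 0)) P0))
length-filter-range± P? P0 neg⇒pos pos⇒neg (suc m) = begin
  length (filter P? (+ suc m ∷ -[1+ m ] ∷ range± m))
    ≡⟨ length-filter-∷ P? (+ suc m) _ ⟩
  𝟙 (P? (+ suc m)) + length (filter P? (-[1+ m ] ∷ range± m))
    ≡⟨ cong (λ k → 𝟙 (P? (+ suc m)) + k) (length-filter-∷ P? -[1+ m ] _) ⟩
  𝟙 (P? (+ suc m)) + (𝟙 (P? -[1+ m ]) + length (filter P? (range± m)))
    ≡⟨ cong (λ k → 𝟙 (P? (+ suc m)) + (k + length (filter P? (range± m))))
            (𝟙-cong (P? -[1+ m ]) (P? (+ suc m)) neg⇒pos pos⇒neg) ⟩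
  𝟙 (P? (+ suc m)) + (𝟙 (P? (+ suc m)) + length (filter P? (range± m)))
    ≡⟨ cong (λ k → 𝟙 (P? (+ suc m)) + (𝟙 (P? (+ suc m)) + k))
            (length-filter-range± P? P0 neg⇒pos pos⇒neg m) ⟩
  𝟙 (P? (+ suc m)) + (𝟙 (P? (+ suc m)) + suc (2 * ∑[ d < m ] 𝟙 (P? (+ suc d))))
    ≡⟨ regroup (𝟙 (P? (+ suc m))) (∑[ d < m ] 𝟙 (P? (+ suc d))) ⟩
  suc (2 * ∑[ d < suc m ] 𝟙 (P? (+ suc d))) ∎
  where
  open ≡-Reasoning
  regroup : ∀ a s → a + (a + suc (2 * s)) ≡ suc (2 * (s + a))
  regroup = solve-∀

length-deduplicate : ∀ xs {ys} → Unique ys → (∀ {z} → z ∈ xs → z ∈ ys) →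
                     length (deduplicate ℤP._≟_ xs) ≡ length (filter (_∈? xs) ys)
length-deduplicate xs {ys} ys! xs⊆ys = ↭-length (∼bag⇒↭
  (unique∧set⇒bag (deduplicate-! xs) (Unique.filter⁺ (_∈? xs) {ys} ys!) (mk⇔ to from)))
  where
  to : ∀ {z} → z ∈ deduplicate ℤP._≟_ xs → z ∈ filter (_∈? xs) ys
  to z∈ = let z∈xs = Equivalence.from (deduplicate-∈⇔ ℤP._≟_) z∈ in
          ∈-filter⁺ (_∈? xs) {xs = ys} (xs⊆ys z∈xs) z∈xs
  from : ∀ {z} → z ∈ filter (_∈? xs) ys → z ∈ deduplicate ℤP._≟_ xs
  from z∈ = Equivalence.to (deduplicate-∈⇔ ℤP._≟_) (proj₂ (∈-filter⁻ (_∈? xs) {xs = ys} z∈))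

positiveDifferences : ℕ → List ℕ → ℕ
positiveDifferences m S = ∑[ d < m ] 𝟙 (+ suc d ∈? differences S)

diffSetSize≡ : ∀ m S {x} → x ∈ S → (∀ {y} → y ∈ S → y ≤ m) →
               diffSetSize S ≡ suc (2 * positiveDifferences m S)
diffSetSize≡ m S x∈S bound =
  trans (length-deduplicate (differences S) (range±-unique m)
                            (λ z∈ → ∈-range±⁺ m _ (∈-differences⇒∣∣≤ S bound z∈)))
        (length-filter-range± (_∈? differences S) (0∈-differences S x∈S)
                              (neg-∈-differences S) (neg-∈-differences S) m)

DiffsUpTo : ℕ → List ℕ → Set
DiffsUpTo a S = ∀ {d} → d < a → + suc d ∈ differences S

diffsUpTo? : ∀ a S → Dec (DiffsUpTo a S)
diffsUpTo? a S = allUpTo? (λ d → + suc d ∈? differences S) a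

positiveDifferences-+ : ∀ a L S → DiffsUpTo a S →
  positiveDifferences (a + L) S ≡ a + ∑[ i < L ] 𝟙 (+ suc (a + i) ∈? differences S)
positiveDifferences-+ a L S all =
  trans (∑<-+ a L _) (cong (_+ ∑[ i < L ] 𝟙 (+ suc (a + i) ∈? differences S)) (begin
    ∑[ d < a ] 𝟙 (+ suc d ∈? differences S) ≡⟨ ∑<-cong a (λ d<a → 𝟙-yes _ (all d<a)) ⟩
    ∑[ d < a ] 1                              ≡⟨ ∑<-const a 1 ⟩
    a * 1                                     ≡⟨ *-identityʳ a ⟩
    a                                         ∎))
  where open ≡-Reasoning

∈-differences-toSet⁺ : ∀ bs {x d} → mem bs x ≡ true → mem bs (x + d) ≡ true →
                       + d ∈ differences (toSet bs)
∈-differences-toSet⁺ bs x∈ x+d∈ =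
  +∈-differences⁺ (toSet bs) (mem⇒∈-toSet bs x∈) (mem⇒∈-toSet bs x+d∈)

∈-differences-toSet⁻ : ∀ bs {d} → + d ∈ differences (toSet bs) →
                       ∃[ x ] mem bs x ≡ true × mem bs (x + d) ≡ true
∈-differences-toSet⁻ bs d∈ with +∈-differences⁻ (toSet bs) d∈
... | x , x∈ , x+d∈ = x , ∈-toSet⇒mem bs x∈ , ∈-toSet⇒mem bs x+d∈

mem-delete-below : ∀ xs c ys {x} → x < length ys → mem (xs ++ c ∷ ys) x ≡ mem (xs ++ ys) x
mem-delete-below xs c ys {x} x<ys = begin
  mem (xs ++ c ∷ ys) x ≡⟨ mem-++ˡ xs (c ∷ ys) (m<n⇒m<1+n x<ys) ⟩
  mem (c ∷ ys) x       ≡⟨ mem-++ˡ [ c ] ys x<ys ⟩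
  mem ys x             ≡⟨ mem-++ˡ xs ys x<ys ⟨
  mem (xs ++ ys) x     ∎
  where open ≡-Reasoning

mem-delete-above : ∀ xs c ys {j} → length ys ≤ j → mem (xs ++ c ∷ ys) (suc j) ≡ mem (xs ++ ys) j
mem-delete-above xs c ys {j} ys≤j =
  subst (λ j → mem (xs ++ c ∷ ys) (suc j) ≡ mem (xs ++ ys) j) (m+[n∸m]≡n ys≤j)
        (trans (mem-++ʳ xs (c ∷ ys) (j ∸ length ys)) (sym (mem-++ʳ xs ys (j ∸ length ys))))

x+e<|xs++ys|⇒x<|ys| : ∀ (xs ys : List Bool) {x e} → length xs ≤ e →
                       x + e < length (xs ++ ys) → x < length ys
x+e<|xs++ys|⇒x<|ys| xs ys {x} {e} xs≤e x+e< = +-cancelʳ-< e x (length ys) (begin-strict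
  x + e                 <⟨ x+e< ⟩
  length (xs ++ ys)     ≡⟨ length-++ xs ⟩
  length xs + length ys ≤⟨ +-monoˡ-≤ (length ys) xs≤e ⟩
  e + length ys         ≡⟨ +-comm e (length ys) ⟩
  length ys + e         ∎)
  where open ≤-Reasoning

-- A difference e ≥ |xs|, |ys| can only join an element of ys to one of xs, so deleting the
-- bit c between them shortens it by exactly one.
∈-differences-delete : ∀ xs c ys {e} → length xs ≤ e → length ys ≤ e →
  + suc e ∈ differences (toSet (xs ++ c ∷ ys)) → + e ∈ differences (toSet (xs ++ ys))
∈-differences-delete xs c ys {e} xs≤e ys≤e e+1∈ with ∈-differences-toSet⁻ (xs ++ c ∷ ys) e+1∈
... | x , x∈ , x+e+1∈ = ∈-differences-toSet⁺ (xs ++ ys)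
  (trans (sym (mem-delete-below xs c ys x<ys)) x∈)
  (trans (sym (mem-delete-above xs c ys (≤-trans ys≤e (m≤n+m e x)))) x+e+1∈′)
  where
  x+e+1∈′ : mem (xs ++ c ∷ ys) (suc (x + e)) ≡ true
  x+e+1∈′ = subst (λ k → mem (xs ++ c ∷ ys) k ≡ true) (+-suc x e) x+e+1∈
  x<ys : x < length ys
  x<ys = x+e<|xs++ys|⇒x<|ys| xs ys {x} {e} xs≤e (≤-pred (subst₂ _<_ (+-suc x e)
           (length-++-sucʳ xs c ys) (mem-true⇒< (xs ++ c ∷ ys) x+e+1∈)))

∈-differences-insert : ∀ xs c ys {e} → length xs ≤ e → length ys ≤ e →
  + e ∈ differences (toSet (xs ++ ys)) → + suc e ∈ differences (toSet (xs ++ c ∷ ys))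
∈-differences-insert xs c ys {e} xs≤e ys≤e e∈ with ∈-differences-toSet⁻ (xs ++ ys) e∈
... | x , x∈ , x+e∈ = ∈-differences-toSet⁺ (xs ++ c ∷ ys)
  (trans (mem-delete-below xs c ys x<ys) x∈)
  (subst (λ k → mem (xs ++ c ∷ ys) k ≡ true) (sym (+-suc x e))
         (trans (mem-delete-above xs c ys (≤-trans ys≤e (m≤n+m e x))) x+e∈))
  where
  x<ys : x < length ys
  x<ys = x+e<|xs++ys|⇒x<|ys| xs ys {x} {e} xs≤e (mem-true⇒< (xs ++ ys) x+e∈)

diffSetSize-delete : ∀ {a L} xs c ys → length xs ≡ suc a → length ys ≡ L → L ≤ suc a → 0 < a →
  DiffsUpTo (suc a) (toSet (xs ++ c ∷ ys)) → DiffsUpTo a (toSet (xs ++ ys)) →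
  diffSetSize (toSet (xs ++ c ∷ ys)) ≡ 2 + diffSetSize (toSet (xs ++ ys))
diffSetSize-delete {a} {L} xs c ys |xs| |ys| L≤a 0<a all all′ = begin
  diffSetSize S
    ≡⟨ diffSetSize≡ (suc a + L) S (proj₁ (proj₂ (+∈-differences⁻ S (all z<s))))
                    (∈-toSet⇒≤ (xs ++ c ∷ ys) (≤-reflexive |S|)) ⟩
  suc (2 * positiveDifferences (suc a + L) S)
    ≡⟨ cong (λ k → suc (2 * k)) (positiveDifferences-+ (suc a) L S all) ⟩
  suc (2 * (suc a + ∑[ i < L ] 𝟙 (+ suc (suc a + i) ∈? differences S)))
    ≡⟨ cong (λ k → suc (2 * (suc a + k))) (∑<-cong L (λ _ → shorter _)) ⟩
  suc (2 * (suc a + ∑[ i < L ] 𝟙 (+ suc (a + i) ∈? differences S′)))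
    ≡⟨ regroup a _ ⟩
  2 + suc (2 * (a + ∑[ i < L ] 𝟙 (+ suc (a + i) ∈? differences S′)))
    ≡⟨ cong (λ k → 2 + suc (2 * k)) (positiveDifferences-+ a L S′ all′) ⟨
  2 + suc (2 * positiveDifferences (a + L) S′)
    ≡⟨ cong (λ k → 2 + k) (diffSetSize≡ (a + L) S′ (proj₁ (proj₂ (+∈-differences⁻ S′ (all′ 0<a))))
                                 (∈-toSet⇒≤ (xs ++ ys) (≤-reflexive |S′|))) ⟨
  2 + diffSetSize S′ ∎
  where
  open ≡-Reasoning
  S  = toSet (xs ++ c ∷ ys)
  S′ = toSet (xs ++ ys)
  |S| : length (xs ++ c ∷ ys) ≡ suc (suc a + L)
  |S| = trans (length-++ xs) (trans (cong₂ _+_ |xs| (cong suc |ys|)) (+-suc (suc a) L))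
  |S′| : length (xs ++ ys) ≡ suc (a + L)
  |S′| = trans (length-++ xs) (cong₂ _+_ |xs| |ys|)
  shorter : ∀ i → 𝟙 (+ suc (suc a + i) ∈? differences S) ≡ 𝟙 (+ suc (a + i) ∈? differences S′)
  shorter i =
    𝟙-cong _ _ (∈-differences-delete xs c ys xs≤ ys≤) (∈-differences-insert xs c ys xs≤ ys≤)
    where
    xs≤ : length xs ≤ suc (a + i)
    xs≤ = ≤-trans (≤-reflexive |xs|) (s≤s (m≤m+n a i))
    ys≤ : length ys ≤ suc (a + i)
    ys≤ = ≤-trans (≤-reflexive |ys|) (≤-trans L≤a (s≤s (m≤m+n a i)))
  regroup : ∀ a x → suc (2 * (suc a + x)) ≡ 2 + suc (2 * (a + x))
  regroup = solve-∀

defect-delete : ∀ n {a L} xs c ys → length xs ≡ suc a → length ys ≡ L → L ≤ suc a → 0 < a →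
  DiffsUpTo (suc a) (toSet (xs ++ c ∷ ys)) → DiffsUpTo a (toSet (xs ++ ys)) →
  defect n (toSet (xs ++ ys)) ≡ defect n (toSet (xs ++ c ∷ ys)) ℤ.+ + 2
defect-delete n xs c ys |xs| |ys| L≤a 0<a all all′
  rewrite diffSetSize-delete xs c ys |xs| |ys| L≤a 0<a all all′ =
  shift (+ (2 * n) ℤ.- + 1) (+ diffSetSize (toSet (xs ++ ys)))
  where
  shift : ∀ A t → A ℤ.- t ≡ (A ℤ.- (+ 2 ℤ.+ t)) ℤ.+ + 2
  shift = ℤSolver.solve-∀

∑ᵇ-delete : ∀ a L {f h g : List Bool → ℕ} →
  (∀ xs c ys → length xs ≡ a → length ys ≡ L → f (xs ++ c ∷ ys) ≤ h (xs ++ c ∷ ys) + g (xs ++ ys)) →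
  ∑ᵇ (a + suc L) f ≤ ∑ᵇ (a + suc L) h + 2 * ∑ᵇ (a + L) g
∑ᵇ-delete a L {f} {h} {g} le = begin
  ∑ᵇ (a + suc L) f
    ≡⟨ ∑ᵇ-++ a (suc L) f ⟩
  ∑ᵇ a (λ xs → ∑ᵇ L (λ ys → f (xs ++ false ∷ ys)) + ∑ᵇ L (λ ys → f (xs ++ true ∷ ys)))
    ≤⟨ ∑ᵇ-mono a (λ xs |xs| → +-mono-≤ (∑ᵇ-mono L (λ ys |ys| → le xs false ys |xs| |ys|))
                                       (∑ᵇ-mono L (λ ys |ys| → le xs true ys |xs| |ys|))) ⟩
  ∑ᵇ a (λ xs → ∑ᵇ L (λ ys → h (xs ++ false ∷ ys) + g (xs ++ ys))
             + ∑ᵇ L (λ ys → h (xs ++ true ∷ ys) + g (xs ++ ys)))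
    ≡⟨ ∑ᵇ-cong a (λ xs _ → regroup xs) ⟩
  ∑ᵇ a (λ xs → H xs + 2 * G xs)
    ≡⟨ ∑ᵇ-+ a H (λ xs → 2 * G xs) ⟩
  ∑ᵇ a H + ∑ᵇ a (λ xs → 2 * G xs)
    ≡⟨ cong₂ _+_ (∑ᵇ-++ a (suc L) h) (trans (cong (2 *_) (∑ᵇ-++ a L g)) (sym (∑ᵇ-*ˡ a 2 G))) ⟨
  ∑ᵇ (a + suc L) h + 2 * ∑ᵇ (a + L) g ∎
  where
  open ≤-Reasoning
  H G : List Bool → ℕ
  H xs = ∑ᵇ (suc L) (λ zs → h (xs ++ zs))
  G xs = ∑ᵇ L (λ ys → g (xs ++ ys))
  regroup : ∀ xs → ∑ᵇ L (λ ys → h (xs ++ false ∷ ys) + g (xs ++ ys))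
                 + ∑ᵇ L (λ ys → h (xs ++ true ∷ ys) + g (xs ++ ys)) ≡ H xs + 2 * G xs
  regroup xs = trans (cong₂ _+_ (∑ᵇ-+ L (λ ys → h (xs ++ false ∷ ys)) (λ ys → g (xs ++ ys)))
                                (∑ᵇ-+ L (λ ys → h (xs ++ true ∷ ys)) (λ ys → g (xs ++ ys))))
                     (shared (∑ᵇ L (λ ys → h (xs ++ false ∷ ys)))
                             (∑ᵇ L (λ ys → h (xs ++ true ∷ ys))) (G xs))
    where
    shared : ∀ p q r → (p + r) + (q + r) ≡ (p + q) + 2 * r
    shared = solve-∀

lacks : ℕ → List Bool → ℕ
lacks a bs = 𝟙 (¬? (diffsUpTo? a (toSet bs)))

lacking : ℕ → ℕ → ℕ
lacking a n = ∑ᵇ n (lacks a)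

count[2k]≤2*count[2k+2]+lacking : ∀ k {a L} → 0 < a → L ≤ suc a →
  count (suc a + suc L) (2 * k) ≤ lacking (suc a) (suc a + suc L)
                                  + 2 * (count (suc a + suc L) (2 * k + 2) + lacking a (suc a + L))
count[2k]≤2*count[2k+2]+lacking k {a} {L} 0<a L≤a = begin
  count n (2 * k)
    ≡⟨ length-filter-subsets (λ S → defect n S ℤP.≟ + (2 * k)) n ⟩
  ∑ᵇ n (defectIs (2 * k))
    ≤⟨ ∑ᵇ-delete (suc a) L {f = defectIs (2 * k)} {h = lacks (suc a)}
                          {g = λ bs → defectIs (2 * k + 2) bs + lacks a bs} pointwise ⟩
  lacking (suc a) n + 2 * ∑ᵇ (suc a + L) (λ bs → defectIs (2 * k + 2) bs + lacks a bs)
    ≡⟨ cong (λ t → lacking (suc a) n + 2 * t) (∑ᵇ-+ (suc a + L) (defectIs (2 * k + 2)) (lacks a)) ⟩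
  lacking (suc a) n + 2 * (∑ᵇ (suc a + L) (defectIs (2 * k + 2)) + lacking a (suc a + L))
    ≤⟨ +-monoʳ-≤ (lacking (suc a) n) (*-monoʳ-≤ 2 (+-monoˡ-≤ (lacking a (suc a + L)) ∑ᵇ≤count)) ⟩
  lacking (suc a) n + 2 * (count n (2 * k + 2) + lacking a (suc a + L)) ∎
  where
  open ≤-Reasoning
  n = suc a + suc L
  defectIs : ℕ → List Bool → ℕ
  defectIs j bs = 𝟙 (defect n (toSet bs) ℤP.≟ + j)
  pointwise : ∀ xs c ys → length xs ≡ suc a → length ys ≡ L →
    defectIs (2 * k) (xs ++ c ∷ ys) ≤
      lacks (suc a) (xs ++ c ∷ ys) + (defectIs (2 * k + 2) (xs ++ ys) + lacks a (xs ++ ys))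
  pointwise xs c ys |xs| |ys|
    with diffsUpTo? (suc a) (toSet (xs ++ c ∷ ys)) | diffsUpTo? a (toSet (xs ++ ys))
  ... | no _    | _        = ≤-trans (𝟙≤1 _) (m≤m+n 1 _)
  ... | yes _   | no _     = ≤-trans (𝟙≤1 _) (m≤n+m 1 _)
  ... | yes all | yes all′ =
    ≤-trans (𝟙-mono (defect n (toSet (xs ++ c ∷ ys)) ℤP.≟ + (2 * k))
                    (defect n (toSet (xs ++ ys)) ℤP.≟ + (2 * k + 2))
                    (λ eq → trans (defect-delete n xs c ys |xs| |ys| L≤a 0<a all all′)
                                  (cong (ℤ._+ + 2) eq)))
            (m≤m+n _ 0)
  -- toSet (false ∷ bs) = toSet bs, so the sets S′ ⊆ [n − 1] are among the subsets of [n].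
  ∑ᵇ≤count : ∑ᵇ (suc a + L) (defectIs (2 * k + 2)) ≤ count n (2 * k + 2)
  ∑ᵇ≤count = begin
    ∑ᵇ (suc a + L) (defectIs (2 * k + 2))
      ≤⟨ m≤m+n _ _ ⟩
    ∑ᵇ (suc (suc a + L)) (defectIs (2 * k + 2))
      ≡⟨ cong (λ m → ∑ᵇ m (defectIs (2 * k + 2))) (+-suc (suc a) L) ⟨
    ∑ᵇ n (defectIs (2 * k + 2))
      ≡⟨ length-filter-subsets (λ S → defect n S ℤP.≟ + (2 * k + 2)) n ⟨
    count n (2 * k + 2) ∎

missing : ℕ → ℕ → ℕ
missing d n = ∑ᵇ n (λ bs → 𝟙 (¬? (+ d ∈? differences (toSet bs))))

lacking≤∑missing : ∀ a n → lacking a n ≤ ∑[ d < a ] missing (suc d) n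
lacking≤∑missing a n = ≤-trans
  (∑ᵇ-mono n (λ bs _ → 𝟙-¬all≤∑ (λ d → + suc d ∈? differences (toSet bs)) a))
  (≤-reflexive (∑ᵇ-∑< n a (λ d bs → 𝟙 (¬? (+ suc d ∈? differences (toSet bs))))))

missing≤2^ : ∀ d n → missing d n ≤ 2 ^ n
missing≤2^ d n = ≤-trans (∑ᵇ-≤ n (λ bs → 𝟙≤1 (¬? (+ d ∈? differences (toSet bs)))))
                         (≤-reflexive (*-identityʳ (2 ^ n)))

disjoint : List Bool → List Bool → ℕ
disjoint (true ∷ us) (true ∷ vs) = 0
disjoint (_ ∷ us)    (_ ∷ vs)    = disjoint us vs
disjoint _           _           = 1

∑ᵇ-disjoint : ∀ p → ∑ᵇ p (λ us → ∑ᵇ p (λ vs → disjoint us vs)) ≡ 3 ^ p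
∑ᵇ-disjoint zero    = refl
∑ᵇ-disjoint (suc p) = begin
  ∑ᵇ p (λ us → F us + F us) + ∑ᵇ p (λ us → F us + ∑ᵇ p (λ _ → 0))
    ≡⟨ cong₂ _+_ (∑ᵇ-+ p F F)
                 (∑ᵇ-cong p (λ us _ →
                   trans (cong (λ k → F us + k) (∑ᵇ-zero p)) (+-identityʳ (F us)))) ⟩
  (∑ᵇ p F + ∑ᵇ p F) + ∑ᵇ p F
    ≡⟨ cong (λ k → (k + k) + k) (∑ᵇ-disjoint p) ⟩
  (3 ^ p + 3 ^ p) + 3 ^ p
    ≡⟨ thrice (3 ^ p) ⟩
  3 ^ suc p ∎
  where
  open ≡-Reasoning
  F : List Bool → ℕ
  F us = ∑ᵇ p (λ vs → disjoint us vs)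
  thrice : ∀ x → (x + x) + x ≡ 3 * x
  thrice = solve-∀

disjoint≡0⇒common : ∀ us vs → length us ≡ length vs → disjoint us vs ≡ 0 →
                    ∃[ t ] mem us t ≡ true × mem vs t ≡ true
disjoint≡0⇒common (true ∷ us) (true ∷ vs) |us|≡|vs| _ =
  length us , mem-∷-length true us ,
  subst (λ k → mem (true ∷ vs) k ≡ true) (sym (suc-injective |us|≡|vs|)) (mem-∷-length true vs)
disjoint≡0⇒common (false ∷ us) (v ∷ vs) |us|≡|vs| d≡0
  with t , t∈us , t∈vs ← disjoint≡0⇒common us vs (suc-injective |us|≡|vs|) d≡0 =
  t , mem-++⁺ʳ [ false ] us t∈us , mem-++⁺ʳ [ v ] vs t∈vs
disjoint≡0⇒common (true ∷ us) (false ∷ vs) |us|≡|vs| d≡0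
  with t , t∈us , t∈vs ← disjoint≡0⇒common us vs (suc-injective |us|≡|vs|) d≡0 =
  t , mem-++⁺ʳ [ true ] us t∈us , mem-++⁺ʳ [ false ] vs t∈vs

∈-differences-++⁺ʳ : ∀ xs ys {d} → + d ∈ differences (toSet ys) →
                     + d ∈ differences (toSet (xs ++ ys))
∈-differences-++⁺ʳ xs ys d∈ with ∈-differences-toSet⁻ ys d∈
... | x , x∈ , x+d∈ = ∈-differences-toSet⁺ (xs ++ ys) (mem-++⁺ʳ xs ys x∈) (mem-++⁺ʳ xs ys x+d∈)

∈-differences-across : ∀ us ms vs rest {t} → length us ≡ length vs →
  mem us t ≡ true → mem vs t ≡ true →
  + (length ms + length us) ∈ differences (toSet (us ++ ms ++ vs ++ rest))
∈-differences-across us ms vs rest {t} |us|≡|vs| t∈us t∈vs =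
  ∈-differences-toSet⁺ (us ++ ms ++ vs ++ rest) lower
    (subst (λ k → mem (us ++ ms ++ vs ++ rest) k ≡ true) upper≡ upper)
  where
  x<vs++rest : length rest + t < length (vs ++ rest)
  x<vs++rest = begin-strict
    length rest + t         <⟨ +-monoʳ-< (length rest) (mem-true⇒< vs t∈vs) ⟩
    length rest + length vs ≡⟨ +-comm (length rest) (length vs) ⟩
    length vs + length rest ≡⟨ length-++ vs ⟨
    length (vs ++ rest)     ∎
    where open ≤-Reasoning
  lower : mem (us ++ ms ++ vs ++ rest) (length rest + t) ≡ true
  lower = begin
    mem (us ++ ms ++ vs ++ rest) (length rest + t)
      ≡⟨ mem-++ˡ us (ms ++ vs ++ rest) (<-≤-trans x<vs++rest (length-++-≤ʳ (vs ++ rest) {ms})) ⟩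
    mem (ms ++ vs ++ rest) (length rest + t) ≡⟨ mem-++ˡ ms (vs ++ rest) x<vs++rest ⟩
    mem (vs ++ rest) (length rest + t)       ≡⟨ mem-++ʳ vs rest t ⟩
    mem vs t                                 ≡⟨ t∈vs ⟩
    true                                     ∎
    where open ≡-Reasoning
  upper : mem (us ++ ms ++ vs ++ rest) (length (ms ++ vs ++ rest) + t) ≡ true
  upper = trans (mem-++ʳ us (ms ++ vs ++ rest) t) t∈us
  upper≡ : length (ms ++ vs ++ rest) + t ≡ length rest + t + (length ms + length us)
  upper≡ = begin
    length (ms ++ vs ++ rest) + t             ≡⟨ cong (_+ t) (length-++ ms) ⟩
    length ms + length (vs ++ rest) + t       ≡⟨ cong (λ k → length ms + k + t) (length-++ vs) ⟩
    length ms + (length vs + length rest) + t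
      ≡⟨ cong (λ k → length ms + (k + length rest) + t) |us|≡|vs| ⟨
    length ms + (length us + length rest) + t ≡⟨ regroup (length ms) (length us) (length rest) t ⟩
    length rest + t + (length ms + length us) ∎
    where
    open ≡-Reasoning
    regroup : ∀ m u r t → m + (u + r) + t ≡ r + t + (m + u)
    regroup = solve-∀

-- us and vs lie at distance d, so a common element of theirs would make d a difference.
𝟙-missing-≤ : ∀ us ms vs rest {d} → length us ≡ length vs → length ms + length us ≡ d →
  𝟙 (¬? (+ d ∈? differences (toSet (us ++ ms ++ vs ++ rest))))
    ≤ disjoint us vs * 𝟙 (¬? (+ d ∈? differences (toSet rest)))
𝟙-missing-≤ us ms vs rest {d} |us|≡|vs| refl
  with + d ∈? differences (toSet (us ++ ms ++ vs ++ rest))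
... | yes _ = z≤n
... | no d∉ with + d ∈? differences (toSet rest) | disjoint us vs in disjoint≡
...   | yes d∈rest | _ = contradiction
  (∈-differences-++⁺ʳ us _ (∈-differences-++⁺ʳ ms _ (∈-differences-++⁺ʳ vs rest d∈rest))) d∉
...   | no _ | zero =
  let t , t∈us , t∈vs = disjoint≡0⇒common us vs |us|≡|vs| disjoint≡ in
  contradiction (∈-differences-across us ms vs rest |us|≡|vs| t∈us t∈vs) d∉
...   | no _ | suc _ = s≤s z≤n

missing-block : ∀ p q r → missing (q + p) (p + (q + (p + r))) ≤ 3 ^ p * (2 ^ q * missing (q + p) r)
missing-block p q r = begin
  missing d (p + (q + (p + r)))
    ≡⟨ trans (∑ᵇ-++ p _ f) (∑ᵇ-cong p (λ us _ →
         trans (∑ᵇ-++ q _ _) (∑ᵇ-cong q (λ ms _ → ∑ᵇ-++ p r _)))) ⟩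
  ∑ᵇ p (λ us → ∑ᵇ q (λ ms → ∑ᵇ p (λ vs → ∑ᵇ r (λ rest → f (us ++ ms ++ vs ++ rest)))))
    ≤⟨ ∑ᵇ-mono p (λ us |us| → ∑ᵇ-mono q (λ ms |ms| → ∑ᵇ-mono p (λ vs |vs| → ∑ᵇ-mono r (λ rest _ →
         𝟙-missing-≤ us ms vs rest (trans |us| (sym |vs|)) (cong₂ _+_ |ms| |us|))))) ⟩
  ∑ᵇ p (λ us → ∑ᵇ q (λ ms → ∑ᵇ p (λ vs → ∑ᵇ r (λ rest → disjoint us vs * f rest))))
    ≡⟨ ∑ᵇ-cong p (λ us _ → ∑ᵇ-cong q (λ ms _ → ∑ᵇ-cong p (λ vs _ → ∑ᵇ-*ˡ r (disjoint us vs) f))) ⟩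
  ∑ᵇ p (λ us → ∑ᵇ q (λ ms → ∑ᵇ p (λ vs → disjoint us vs * missing d r)))
    ≡⟨ ∑ᵇ-cong p (λ us _ →
         trans (∑ᵇ-const q _) (cong (2 ^ q *_) (∑ᵇ-*ʳ p (disjoint us) (missing d r)))) ⟩
  ∑ᵇ p (λ us → 2 ^ q * (∑ᵇ p (disjoint us) * missing d r))
    ≡⟨ trans (∑ᵇ-*ˡ p (2 ^ q) _) (cong (2 ^ q *_) (∑ᵇ-*ʳ p _ (missing d r))) ⟩
  2 ^ q * (∑ᵇ p (λ us → ∑ᵇ p (disjoint us)) * missing d r)
    ≡⟨ cong (λ k → 2 ^ q * (k * missing d r)) (∑ᵇ-disjoint p) ⟩
  2 ^ q * (3 ^ p * missing d r)
    ≡⟨ *-left-comm (2 ^ q) (3 ^ p) (missing d r) ⟩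
  3 ^ p * (2 ^ q * missing d r) ∎
  where
  open ≤-Reasoning
  d = q + p
  f : List Bool → ℕ
  f bs = 𝟙 (¬? (+ d ∈? differences (toSet bs)))

4^*2^≡2^ : ∀ k m → 4 ^ k * 2 ^ m ≡ 2 ^ (k + (k + m))
4^*2^≡2^ zero    m = +-identityʳ (2 ^ m)
4^*2^≡2^ (suc k) m = begin
  4 * 4 ^ k * 2 ^ m           ≡⟨ *-assoc 4 (4 ^ k) (2 ^ m) ⟩
  4 * (4 ^ k * 2 ^ m)         ≡⟨ cong (4 *_) (4^*2^≡2^ k m) ⟩
  4 * 2 ^ (k + (k + m))       ≡⟨ *-assoc 2 2 (2 ^ (k + (k + m))) ⟩
  2 * (2 * 2 ^ (k + (k + m))) ≡⟨ cong (λ e → 2 * 2 ^ e) (+-suc k (k + m)) ⟨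
  2 ^ (suc k + (suc k + m))   ∎
  where open ≡-Reasoning

missing-one-block : ∀ p q r →
  4 ^ p * missing (q + p) (p + (q + (p + r))) ≤ 3 ^ p * 2 ^ (p + (q + (p + r)))
missing-one-block p q r = begin
  4 ^ p * missing (q + p) (p + (q + (p + r)))
    ≤⟨ *-monoʳ-≤ (4 ^ p) (missing-block p q r) ⟩
  4 ^ p * (3 ^ p * (2 ^ q * missing (q + p) r))
    ≤⟨ *-monoʳ-≤ (4 ^ p) (*-monoʳ-≤ (3 ^ p) (*-monoʳ-≤ (2 ^ q) (missing≤2^ (q + p) r))) ⟩
  4 ^ p * (3 ^ p * (2 ^ q * 2 ^ r))
    ≡⟨ *-left-comm (4 ^ p) (3 ^ p) _ ⟩
  3 ^ p * (4 ^ p * (2 ^ q * 2 ^ r))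
    ≡⟨ cong (λ k → 3 ^ p * (4 ^ p * k)) (^-distribˡ-+-* 2 q r) ⟨
  3 ^ p * (4 ^ p * 2 ^ (q + r))
    ≡⟨ cong (3 ^ p *_) (4^*2^≡2^ p (q + r)) ⟩
  3 ^ p * 2 ^ (p + (p + (q + r)))
    ≡⟨ cong (λ m → 3 ^ p * 2 ^ m) (layout p q r) ⟩
  3 ^ p * 2 ^ (p + (q + (p + r))) ∎
  where
  open ≤-Reasoning
  layout : ∀ p q r → p + (p + (q + r)) ≡ p + (q + (p + r))
  layout = solve-∀

-- Blocks of min(p, d) disjoint pairs {x, x + d}: one block if p ≤ d, otherwise a block of d
-- pairs followed by recursion on the remaining p − d pairs.
missing-bound : ∀ p {d n} → 0 < d → 4 * p ≤ n → p + d ≤ n → 4 ^ p * missing d n ≤ 3 ^ p * 2 ^ n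
missing-bound p = bound (<-wellFounded p)
  where
  open ≤-Reasoning
  bound : ∀ {p} → Acc _<_ p → ∀ {d n} → 0 < d → 4 * p ≤ n → p + d ≤ n →
          4 ^ p * missing d n ≤ 3 ^ p * 2 ^ n
  bound {p} _ {d} 0<d _ p+d≤n with p ≤? d
  ... | yes p≤d with q , refl ← m≤n⇒∃[o]m+o≡n p≤d | r , refl ← m≤n⇒∃[o]m+o≡n p+d≤n =
    subst₂ (λ e m → 4 ^ p * missing e m ≤ 3 ^ p * 2 ^ m) (+-comm q p) (layout p q r)
           (missing-one-block p q r)
    where
    layout : ∀ p q r → p + (q + (p + r)) ≡ p + (p + q) + r
    layout = solve-∀
  bound {p} (acc smaller) {d} 0<d 4p≤n _ | no p≰d
    with p′ , refl ← m≤n⇒∃[o]m+o≡n (<⇒≤ (≰⇒> p≰d)) | r₁ , refl ← m≤n⇒∃[o]m+o≡n 4p≤n = begin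
    4 ^ (d + p′) * missing d (4 * (d + p′) + r₁)
      ≡⟨ cong₂ (λ a m → a * missing d m) (^-distribˡ-+-* 4 d p′) (layout d p′ r₁) ⟩
    4 ^ d * 4 ^ p′ * missing d (d + (0 + (d + r)))
      ≤⟨ *-monoʳ-≤ (4 ^ d * 4 ^ p′) (missing-block d 0 r) ⟩
    4 ^ d * 4 ^ p′ * (3 ^ d * (1 * missing d r))
      ≡⟨ regroup (4 ^ d) (4 ^ p′) (3 ^ d) (missing d r) ⟩
    3 ^ d * (4 ^ d * (4 ^ p′ * missing d r))
      ≤⟨ *-monoʳ-≤ (3 ^ d) (*-monoʳ-≤ (4 ^ d) remaining) ⟩
    3 ^ d * (4 ^ d * (3 ^ p′ * 2 ^ r))
      ≡⟨ cong (3 ^ d *_) (*-left-comm (4 ^ d) (3 ^ p′) (2 ^ r)) ⟩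
    3 ^ d * (3 ^ p′ * (4 ^ d * 2 ^ r))
      ≡⟨ *-assoc (3 ^ d) (3 ^ p′) _ ⟨
    3 ^ d * 3 ^ p′ * (4 ^ d * 2 ^ r)
      ≡⟨ cong₂ _*_ (^-distribˡ-+-* 3 d p′) (sym (4^*2^≡2^ d r)) ⟨
    3 ^ (d + p′) * 2 ^ (d + (d + r))
      ≡⟨ cong (λ m → 3 ^ (d + p′) * 2 ^ m) (layout d p′ r₁) ⟨
    3 ^ (d + p′) * 2 ^ (4 * (d + p′) + r₁) ∎
    where
    r = (d + d) + (4 * p′ + r₁)
    layout : ∀ d p′ r₁ → 4 * (d + p′) + r₁ ≡ d + (0 + (d + ((d + d) + (4 * p′ + r₁))))
    layout = solve-∀
    regroup : ∀ a b c m → a * b * (c * (1 * m)) ≡ c * (a * (b * m))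
    regroup = solve-∀
    remaining : 4 ^ p′ * missing d r ≤ 3 ^ p′ * 2 ^ r
    remaining = bound (smaller (m<n+m p′ 0<d)) 0<d
      (≤-trans (m≤m+n (4 * p′) r₁) (m≤n+m _ (d + d)))
      (≤-trans (≤-reflexive (+-comm p′ d))
               (+-mono-≤ (m≤m+n d d) (≤-trans (m≤m+n p′ (3 * p′)) (m≤m+n (4 * p′) r₁))))

-- Peel off the top b terms, each at most (3/4)^s B, and recurse on the rest with s + 1.
∑-decay : ∀ b .{{_ : NonZero b}} {n B} {f : ℕ → ℕ} →
  (∀ s d → b * s + suc d ≤ n → 4 ^ s * f d ≤ 3 ^ s * B) →
  ∀ s D → b * s + D ≤ n → 4 ^ s * ∑< D f ≤ 4 * b * (3 ^ s * B)
∑-decay b {n} {B} {f} decay s D = go (<-wellFounded D) s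
  where
  open ≤-Reasoning
  go : ∀ {D} → Acc _<_ D → ∀ s → b * s + D ≤ n → 4 ^ s * ∑< D f ≤ 4 * b * (3 ^ s * B)
  go {D} _ s bs+D≤n with D ≤? b
  ... | yes D≤b = begin
    4 ^ s * ∑< D f           ≡⟨ *-distribˡ-∑< (4 ^ s) D f ⟩
    ∑[ d < D ] (4 ^ s * f d) ≤⟨ ∑<-≤ D (λ d<D → decay s _ (≤-trans (+-monoʳ-≤ _ d<D) bs+D≤n)) ⟩
    D * (3 ^ s * B)          ≤⟨ *-monoˡ-≤ (3 ^ s * B) D≤b ⟩
    b * (3 ^ s * B)          ≤⟨ *-monoˡ-≤ (3 ^ s * B) (m≤n*m b 4) ⟩
    4 * b * (3 ^ s * B)      ∎
  go {D} (acc smaller) s bs+D≤n | no D≰b with D′ , refl ← m≤n⇒∃[o]m+o≡n (<⇒≤ (≰⇒> D≰b)) = begin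
    4 ^ s * ∑< (b + D′) f
      ≡⟨ cong (λ m → 4 ^ s * ∑< m f) (+-comm b D′) ⟩
    4 ^ s * ∑< (D′ + b) f
      ≡⟨ cong (4 ^ s *_) (∑<-+ D′ b f) ⟩
    4 ^ s * (∑< D′ f + ∑[ i < b ] f (D′ + i))
      ≡⟨ *-distribˡ-+ (4 ^ s) _ _ ⟩
    4 ^ s * ∑< D′ f + 4 ^ s * ∑[ i < b ] f (D′ + i)
      ≤⟨ +-mono-≤ lower upper ⟩
    3 * b * (3 ^ s * B) + b * (3 ^ s * B)
      ≡⟨ split b (3 ^ s * B) ⟨
    4 * b * (3 ^ s * B) ∎
    where
    split : ∀ b x → 4 * b * x ≡ 3 * b * x + b * x
    split = solve-∀
    upper : 4 ^ s * ∑[ i < b ] f (D′ + i) ≤ b * (3 ^ s * B)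
    upper = begin
      4 ^ s * ∑[ i < b ] f (D′ + i)   ≡⟨ *-distribˡ-∑< (4 ^ s) b _ ⟩
      ∑[ i < b ] (4 ^ s * f (D′ + i))
        ≤⟨ ∑<-≤ b (λ i<b → decay s _ (≤-trans (+-monoʳ-≤ (b * s) (top i<b)) bs+D≤n)) ⟩
      b * (3 ^ s * B)                  ∎
      where
      top : ∀ {i} → i < b → suc (D′ + i) ≤ b + D′
      top {i} i<b = subst₂ _≤_ (+-suc D′ i) (+-comm D′ b) (+-monoʳ-≤ D′ i<b)
    lower : 4 ^ s * ∑< D′ f ≤ 3 * b * (3 ^ s * B)
    lower = *-cancelˡ-≤ 4 (begin
      4 * (4 ^ s * ∑< D′ f)     ≡⟨ *-assoc 4 (4 ^ s) _ ⟨
      4 ^ suc s * ∑< D′ f       ≤⟨ go (smaller (m<n+m D′ (>-nonZero⁻¹ b))) (suc s)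
                                      (≤-trans (≤-reflexive (shift b s D′)) bs+D≤n) ⟩
      4 * b * (3 ^ suc s * B)   ≡⟨ regroup b (3 ^ s) B ⟩
      4 * (3 * b * (3 ^ s * B)) ∎)
      where
      shift : ∀ b s D′ → b * suc s + D′ ≡ b * s + (b + D′)
      shift = solve-∀
      regroup : ∀ b t B → 4 * b * (3 * t * B) ≡ 4 * (3 * b * (t * B))
      regroup = solve-∀

lacking-bound : ∀ s a m → 4 * s + a ≤ m → 4 ^ s * lacking a m ≤ 16 * (3 ^ s * 2 ^ m)
lacking-bound s a m 4s+a≤m = begin
  4 ^ s * lacking a m                  ≤⟨ *-monoʳ-≤ (4 ^ s) (lacking≤∑missing a m) ⟩
  4 ^ s * ∑[ d < a ] missing (suc d) m ≤⟨ ∑-decay 4 decay s a 4s+a≤m ⟩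
  16 * (3 ^ s * 2 ^ m)                 ∎
  where
  open ≤-Reasoning
  decay : ∀ s d → 4 * s + suc d ≤ m → 4 ^ s * missing (suc d) m ≤ 3 ^ s * 2 ^ m
  decay s d 4s+d<m = missing-bound s z<s (≤-trans (m≤m+n (4 * s) (suc d)) 4s+d<m)
                                         (≤-trans (+-monoˡ-≤ (suc d) (m≤m+n s (3 * s))) 4s+d<m)

bernoulli : ∀ s → 3 ^ s * (3 + s) ≤ 3 * 4 ^ s
bernoulli zero    = ≤-refl
bernoulli (suc s) = begin
  3 ^ suc s * (3 + suc s)           ≡⟨ split (3 ^ s) s ⟩
  3 * (3 ^ s * (3 + s)) + 3 * 3 ^ s ≤⟨ +-mono-≤ (*-monoʳ-≤ 3 (bernoulli s))
                                                (*-monoʳ-≤ 3 (^-monoˡ-≤ s (n≤1+n 3))) ⟩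
  3 * (3 * 4 ^ s) + 3 * 4 ^ s       ≡⟨ merge (4 ^ s) ⟩
  3 * 4 ^ suc s                     ∎
  where
  open ≤-Reasoning
  split : ∀ t s → 3 * t * (3 + suc s) ≡ 3 * (t * (3 + s)) + 3 * t
  split = solve-∀
  merge : ∀ u → 3 * (3 * u) + 3 * u ≡ 3 * (4 * u)
  merge = solve-∀

linear*3^≤4^ : ∀ c → c * 3 ^ (3 * c) ≤ 4 ^ (3 * c)
linear*3^≤4^ c = *-cancelˡ-≤ 3 (begin
  3 * (c * 3 ^ (3 * c))     ≡⟨ regroup c (3 ^ (3 * c)) ⟩
  3 ^ (3 * c) * (3 * c)     ≤⟨ *-monoʳ-≤ (3 ^ (3 * c)) (m≤n+m (3 * c) 3) ⟩
  3 ^ (3 * c) * (3 + 3 * c) ≤⟨ bernoulli (3 * c) ⟩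
  3 * 4 ^ (3 * c)           ∎)
  where
  open ≤-Reasoning
  regroup : ∀ c t → 3 * (c * t) ≡ t * (3 * c)
  regroup = solve-∀

count-bound : ∀ k K s a → 16 * K * 3 ^ s ≤ 4 ^ s → 0 < a → 4 * s ≤ suc a →
  let n = suc a + suc (4 * s) in K * count n (2 * k) ≤ 2 * K * count n (2 * k + 2) + 2 ^ suc n
count-bound k K s a 16K3^s≤4^s 0<a L≤a = begin
  K * count n (2 * k)
    ≤⟨ *-monoʳ-≤ K (count[2k]≤2*count[2k+2]+lacking k 0<a L≤a) ⟩
  K * (lacking (suc a) n + 2 * (count n (2 * k + 2) + lacking a (suc a + L)))
    ≡⟨ regroup K (lacking (suc a) n) (count n (2 * k + 2)) (lacking a (suc a + L)) ⟩
  2 * K * count n (2 * k + 2) + K * X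
    ≤⟨ +-monoʳ-≤ (2 * K * count n (2 * k + 2)) KX≤2^[n+1] ⟩
  2 * K * count n (2 * k + 2) + 2 ^ suc n ∎
  where
  open ≤-Reasoning
  L = 4 * s
  n = suc a + suc L
  X = lacking (suc a) n + 2 * lacking a (suc a + L)
  regroup : ∀ K x c y → K * (x + 2 * (c + y)) ≡ 2 * K * c + K * (x + 2 * y)
  regroup = solve-∀
  2^n≡ : 2 ^ n ≡ 2 * 2 ^ (suc a + L)
  2^n≡ = cong (2 ^_) (+-suc (suc a) L)
  4^sX≤ : 4 ^ s * X ≤ 32 * (3 ^ s * 2 ^ n)
  4^sX≤ = begin
    4 ^ s * X
      ≡⟨ distrib (4 ^ s) (lacking (suc a) n) (lacking a (suc a + L)) ⟩
    4 ^ s * lacking (suc a) n + 2 * (4 ^ s * lacking a (suc a + L))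
      ≤⟨ +-mono-≤ (lacking-bound s (suc a) n L+a+1≤n)
                  (*-monoʳ-≤ 2 (lacking-bound s a (suc a + L) L+a≤n-1)) ⟩
    16 * (3 ^ s * 2 ^ n) + 2 * (16 * (3 ^ s * 2 ^ (suc a + L)))
      ≡⟨ cong (λ t → 16 * (3 ^ s * t) + 2 * (16 * (3 ^ s * 2 ^ (suc a + L)))) 2^n≡ ⟩
    16 * (3 ^ s * (2 * 2 ^ (suc a + L))) + 2 * (16 * (3 ^ s * 2 ^ (suc a + L)))
      ≡⟨ merge (3 ^ s) (2 ^ (suc a + L)) ⟩
    32 * (3 ^ s * (2 * 2 ^ (suc a + L)))
      ≡⟨ cong (λ t → 32 * (3 ^ s * t)) 2^n≡ ⟨
    32 * (3 ^ s * 2 ^ n) ∎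
    where
    L+a+1≤n : L + suc a ≤ n
    L+a+1≤n = ≤-trans (≤-reflexive (+-comm L (suc a))) (+-monoʳ-≤ (suc a) (n≤1+n L))
    L+a≤n-1 : L + a ≤ suc a + L
    L+a≤n-1 = ≤-trans (≤-reflexive (+-comm L a)) (n≤1+n (a + L))
    distrib : ∀ w x y → w * (x + 2 * y) ≡ w * x + 2 * (w * y)
    distrib = solve-∀
    merge : ∀ t u → 16 * (t * (2 * u)) + 2 * (16 * (t * u)) ≡ 32 * (t * (2 * u))
    merge = solve-∀
  KX≤2^[n+1] : K * X ≤ 2 ^ suc n
  KX≤2^[n+1] = *-cancelˡ-≤ (4 ^ s) {{m^n≢0 4 s}} (begin
    4 ^ s * (K * X)              ≡⟨ *-left-comm (4 ^ s) K X ⟩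
    K * (4 ^ s * X)              ≤⟨ *-monoʳ-≤ K 4^sX≤ ⟩
    K * (32 * (3 ^ s * 2 ^ n))   ≡⟨ regroup′ K (3 ^ s) (2 ^ n) ⟩
    2 * (16 * K * 3 ^ s) * 2 ^ n ≤⟨ *-monoˡ-≤ (2 ^ n) (*-monoʳ-≤ 2 16K3^s≤4^s) ⟩
    2 * 4 ^ s * 2 ^ n            ≡⟨ regroup″ (4 ^ s) (2 ^ n) ⟩
    4 ^ s * 2 ^ suc n            ∎)
    where
    regroup′ : ∀ K t u → K * (32 * (t * u)) ≡ 2 * (16 * K * t) * u
    regroup′ = solve-∀
    regroup″ : ∀ f u → 2 * f * u ≡ f * (2 * u)
    regroup″ = solve-∀

lemma3p5 : ∀ (k m : ℕ) → ∃[ N ] (∀ (n : ℕ) → N ≤ n →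
             suc m * count n (2 * k) ≤ 2 * suc m * count n (2 * k + 2) + 2 ^ suc n)
lemma3p5 k m = suc (suc L) + suc L , bound
  where
  s = 3 * (16 * suc m)
  L = 4 * s
  bound : ∀ n → suc (suc L) + suc L ≤ n →
          suc m * count n (2 * k) ≤ 2 * suc m * count n (2 * k + 2) + 2 ^ suc n
  bound n N≤n with t , refl ← m≤n⇒∃[o]m+o≡n N≤n =
    subst (λ n → suc m * count n (2 * k) ≤ 2 * suc m * count n (2 * k + 2) + 2 ^ suc n)
          (layout L t)
          (count-bound k (suc m) s (suc (L + t)) (linear*3^≤4^ (16 * suc m)) z<s
                       (≤-trans (m≤m+n L t) (≤-trans (n≤1+n _) (n≤1+n _))))
    where
    layout : ∀ L t → suc (suc (L + t)) + suc L ≡ suc (suc L) + suc L + t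
    layout = solve-∀
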